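{- $l^\star=\mathbf{C}_{\mathrm{all}}^{(k)}$, i.e. the optimal cut length equals the $k$-th largest element (counting multiplicities) of the multiset $\mathbf{C}_{\mathrm{all}}$.
   Context: Let $\mathbf{L}=\{L_1,\dots,L_n\}$ be a multiset of positive rationals and $k\in\mathbb{N}_{>0}$. Let $m(l)=\sum_i\lfloor L_i/l\rfloor$ and $l^\star=\max\{l\in\mathbb{Q}_{>0}\mid m(l)\ge k\}$. Let $\mathbf{C}_{\mathrm{all}}=\biguplus_{i=1}^n\{L_i/j\mid j\in\mathbb{N}_{>0}\}$ (multiset union). For a multiset $\mathbf{A}$, $\mathbf{A}^{(r)}$ denotes its $r$-th largest element with multiplicities, i.e. $\mathbf{A}^{(1)}\ge\mathbf{A}^{(2)}\ge\cdots$ lists the elements in non-increasing order. -}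

module Defs where

open import Data.Nat as ℕ using (ℕ; pred)
open import Data.Integer as ℤ using (ℤ; +_)
open import Data.Rational using (ℚ; 0ℚ; _<_; _≤_; _÷_; _/_; _*_; floor; >-nonZero)
open import Data.Fin using (Fin; zero; suc)
open import Data.Product using (Σ; ∃; _×_; _,_)
open import Function.Bundles using (_⤖_; Bijection)
open import Relation.Binary.PropositionalEquality using (_≡_)

sumFin : ∀ {n} → (Fin n → ℤ) → ℤ
sumFin {ℕ.zero} f = + 0
sumFin {ℕ.suc n} f = f zero ℤ.+ sumFin (λ i → f (suc i))

m : ∀ {n} → (Fin n → ℚ) → (l : ℚ) → 0ℚ < l → ℤ
m L l l>0 = sumFin (λ i → floor (_÷_ (L i) l {{>-nonZero l>0}}))

Feasible : ∀ {n} → (Fin n → ℚ) → ℕ → ℚ → Set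
Feasible L k l = Σ (0ℚ < l) (λ l>0 → + k ℤ.≤ m L l l>0)

IsMaxFeasible : ∀ {n} → (Fin n → ℚ) → ℕ → ℚ → Set
IsMaxFeasible L k x = Feasible L k x × (∀ l → Feasible L k l → l ≤ x)

-- The multiset C_all = ⊎_i { L_i / j | j ∈ ℕ_{>0} }, as a family indexed by
-- (i , j) : Fin n × ℕ, where index j stands for the divisor j+1.
Call : ∀ {n} → (Fin n → ℚ) → Fin n × ℕ → ℚ
Call L (i , j) = L i * (+ 1 / ℕ.suc j)

-- x is the r-th largest element (with multiplicities, r ≥ 1) of a countably
-- infinite multiset given as a family val : I → ℚ : there is a listing
-- A^(1), A^(2), ... of all elements (a bijection ℕ ⤖ I, position p ↦ A^(p+1))
-- in non-increasing order whose r-th entry is x.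
IsKthLargest : {I : Set} → (I → ℚ) → ℕ → ℚ → Set
IsKthLargest {I} val r x =
  Σ (ℕ ⤖ I) λ σ →
    (∀ p q → p ℕ.≤ q → val (Bijection.to σ q) ≤ val (Bijection.to σ p))
    × val (Bijection.to σ (pred r)) ≡ x

module Submission where

-- Sort the pieces L_i/(j+1) by decreasing value, breaking ties lexicographically in (i , j), and
-- rank each piece by its number of predecessors. A piece L_i/(j+1) is ≥ l exactly when
-- j < ⌊L_i/l⌋, so at most m(l) pieces are ≥ l; hence ranks are finite, and since the rows are
-- infinite every rank is attained, i.e. ranking enumerates C_all in non-increasing order. If x is
-- the k-th entry, the first k entries are ≥ x, so m(x) ≥ k; and if l > x, every piece ≥ l
-- precedes the k-th one, so m(l) ≤ k - 1.

open import Data.Fin as Fin using (Fin; zero; suc)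
import Data.Fin.Properties as Fin
open import Data.Integer as ℤ using (ℤ; +_; -[1+_]; +≤+)
import Data.Integer.Properties as ℤ
open import Data.List using (List; []; _∷_; length; map; _++_; upTo; filter)
open import Data.List.Properties using (length-map; length-++; length-upTo; length-removeAt′)
open import Data.List.Membership.Propositional using (_∈_; _∉_)
open import Data.List.Membership.Propositional.Properties
  using (∈-map⁺; ∈-map⁻; ∈-++⁺ˡ; ∈-++⁺ʳ; ∈-++⁻; ∈-upTo⁺; ∈-upTo⁻; ∈-filter⁺; ∈-filter⁻)
open import Data.List.Relation.Binary.Subset.Propositional using (_⊆_)
import Data.List.Relation.Unary.All as All
open import Data.List.Relation.Unary.All.Properties using (¬Any⇒All¬)
open import Data.List.Relation.Unary.Any as Any using (here; there; index; any?)
open import Data.List.Relation.Unary.Unique.Propositional using (Unique; []; _∷_)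
import Data.List.Relation.Unary.Unique.Propositional.Properties as Unique
open import Data.Nat as ℕ using (ℕ; zero; suc; z≤n; s≤s)
import Data.Nat.Properties as ℕ
import Data.Nat.DivMod as ℕ
open import Data.Nat.Coprimality using (1-coprimeTo; Coprime) renaming (sym to coprime-sym)
open import Data.Product as Product using (∃; _×_; _,_; proj₁; proj₂)
open import Data.Product.Relation.Binary.Lex.Strict using (×-Lex; ×-isStrictTotalOrder)
open import Data.Product.Relation.Binary.Pointwise.NonDependent using (≡×≡⇒≡)
open import Data.Rational as ℚ using (ℚ; mkℚ; 0ℚ; _÷_; 1/_; floor; *≤*; >-nonZero)
import Data.Rational.Properties as ℚ
open import Data.Sum using (inj₁; inj₂)
open import Function using (_∘_; _on_; flip; _⇔_; mk⇔; Equivalence)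
open import Function.Bundles using (_⤖_; mk↔ₛ′)
open import Function.Construct.Symmetry using (⇔-sym)
open import Function.Properties.Inverse using (↔⇒⤖)
import Function.Related.Propositional as Related
open import Level using (0ℓ)
open import Relation.Binary
  using (DecidableEquality; Rel; IsStrictTotalOrder; Trichotomous; tri<; tri≈; tri>)
import Relation.Binary.Construct.Flip.EqAndOrd as Flip
import Relation.Binary.Construct.On as On
open import Relation.Binary.PropositionalEquality
open import Relation.Nullary using (¬_; yes; no; contradiction)

open import Defs

module _ {A : Set} where

  ∈-─ : ∀ {x y : A} {xs} (y∈xs : y ∈ xs) → x ∈ xs → x ≢ y → x ∈ (xs Any.─ y∈xs)
  ∈-─ (here refl) (here refl) x≢y = contradiction refl x≢y
  ∈-─ (here refl) (there x∈xs) _ = x∈xs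
  ∈-─ (there _) (here refl) _ = here refl
  ∈-─ (there y∈xs) (there x∈xs) x≢y = there (∈-─ y∈xs x∈xs x≢y)

  map-⊆ : ∀ {B : Set} {f : B → A} {xs ys} → (∀ {x} → x ∈ xs → f x ∈ ys) → map f xs ⊆ ys
  map-⊆ {f = f} {ys = ys} f∈ y∈ =
    let x , x∈ , y≡fx = ∈-map⁻ f y∈ in subst (_∈ ys) (sym y≡fx) (f∈ x∈)

  Unique-⊆⇒length≤ : ∀ {xs ys : List A} → Unique xs → xs ⊆ ys → length xs ℕ.≤ length ys
  Unique-⊆⇒length≤ [] _ = z≤n
  Unique-⊆⇒length≤ {x ∷ xs} {ys} (x∉xs ∷ xs!) x∷xs⊆ys = begin
    suc (length xs)                     ≤⟨ s≤s (Unique-⊆⇒length≤ xs! xs⊆ys─x) ⟩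
    suc (length (ys Any.─ x∈ys))        ≡⟨ length-removeAt′ ys (index x∈ys) ⟨
    length ys                           ∎
    where
    open ℕ.≤-Reasoning
    x∈ys = x∷xs⊆ys (here refl)
    xs⊆ys─x : xs ⊆ (ys Any.─ x∈ys)
    xs⊆ys─x z∈xs = ∈-─ x∈ys (x∷xs⊆ys (there z∈xs)) (≢-sym (All.lookup x∉xs z∈xs))

  Unique-⊆⇒length< : ∀ {xs ys : List A} {y} → Unique xs → xs ⊆ ys → y ∈ ys → y ∉ xs →
                     length xs ℕ.< length ys
  Unique-⊆⇒length< xs! xs⊆ys y∈ys y∉xs =
    Unique-⊆⇒length≤ (¬Any⇒All¬ _ y∉xs ∷ xs!) λ { (here refl) → y∈ys ; (there z∈xs) → xs⊆ys z∈xs }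

  Unique-⊆-length≥⇒⊇ : DecidableEquality A → ∀ {xs ys : List A} → Unique xs → xs ⊆ ys →
                       length ys ℕ.≤ length xs → ys ⊆ xs
  Unique-⊆-length≥⇒⊇ _≟_ {xs} xs! xs⊆ys ys≤xs {y} y∈ys with any? (y ≟_) xs
  ... | yes y∈xs = y∈xs
  ... | no y∉xs = contradiction ys≤xs (ℕ.<⇒≱ (Unique-⊆⇒length< xs! xs⊆ys y∈ys y∉xs))

grid : ∀ {n} → (Fin n → ℕ) → List (Fin n × ℕ)
grid {zero}  c = []
grid {suc n} c = map (zero ,_) (upTo (c zero)) ++ map (Product.map₁ suc) (grid (c ∘ suc))

∈-grid⁺ : ∀ {n} (c : Fin n → ℕ) {i j} → j ℕ.< c i → (i , j) ∈ grid c
∈-grid⁺ {suc n} c {zero}  j<c = ∈-++⁺ˡ (∈-map⁺ (zero ,_) (∈-upTo⁺ j<c))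
∈-grid⁺ {suc n} c {suc i} j<c = ∈-++⁺ʳ _ (∈-map⁺ (Product.map₁ suc) (∈-grid⁺ (c ∘ suc) j<c))

∈-grid⁻ : ∀ {n} (c : Fin n → ℕ) {i j} → (i , j) ∈ grid c → j ℕ.< c i
∈-grid⁻ {suc n} c ij∈ with ∈-++⁻ (map (zero ,_) (upTo (c zero))) ij∈
... | inj₁ ij∈row with ∈-map⁻ (zero ,_) ij∈row
...   | _ , j∈ , refl = ∈-upTo⁻ j∈
∈-grid⁻ {suc n} c ij∈ | inj₂ ij∈rest with ∈-map⁻ (Product.map₁ suc) ij∈rest
...   | _ , ij∈′ , refl = ∈-grid⁻ (c ∘ suc) ij∈′

grid-unique : ∀ {n} (c : Fin n → ℕ) → Unique (grid c)
grid-unique {zero}  c = []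
grid-unique {suc n} c = Unique.++⁺
  (Unique.map⁺ (cong proj₂) (Unique.upTo⁺ (c zero)))
  (Unique.map⁺ (λ { {_ , _} {_ , _} refl → refl }) (grid-unique (c ∘ suc)))
  λ (p , q) → rows-disjoint p q
  where
  rows-disjoint : ∀ {e} → e ∈ map (zero ,_) (upTo (c zero)) →
                  e ∉ map (Product.map₁ suc) (grid (c ∘ suc))
  rows-disjoint p q with ∈-map⁻ (zero ,_) p | ∈-map⁻ (Product.map₁ suc) q
  ... | _ , _ , refl | _ , _ , ()

length-grid : ∀ {n} (c : Fin n → ℕ) → + length (grid c) ≡ sumFin (λ i → + c i)
length-grid {zero}  c = refl
length-grid {suc n} c = begin
  + length (map (zero ,_) (upTo (c zero)) ++ map (Product.map₁ suc) (grid (c ∘ suc)))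
    ≡⟨ cong +_ (length-++ (map (zero ,_) (upTo (c zero)))) ⟩
  + (length (map (zero ,_) (upTo (c zero))) ℕ.+ length (map (Product.map₁ suc) (grid (c ∘ suc))))
    ≡⟨ cong₂ (λ a b → + (a ℕ.+ b)) (trans (length-map _ (upTo (c zero))) (length-upTo (c zero)))
                                    (length-map _ (grid (c ∘ suc))) ⟩
  + (c zero ℕ.+ length (grid (c ∘ suc)))
    ≡⟨ ℤ.pos-+ (c zero) _ ⟩
  + c zero ℤ.+ + length (grid (c ∘ suc))
    ≡⟨ cong (ℤ._+_ (+ c zero)) (length-grid (c ∘ suc)) ⟩
  sumFin (λ i → + c i) ∎
  where open ≡-Reasoning

sumFin-cong : ∀ {n} {f g : Fin n → ℤ} → (∀ i → f i ≡ g i) → sumFin f ≡ sumFin g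
sumFin-cong {zero}  f≗g = refl
sumFin-cong {suc n} f≗g = cong₂ ℤ._+_ (f≗g zero) (sumFin-cong (f≗g ∘ suc))

fromℕ : ℕ → ℚ
fromℕ m = mkℚ (+ m) 0 (coprime-sym (1-coprimeTo m))

1/fromℕ : ∀ m → 1/ fromℕ (suc m) ≡ + 1 ℚ./ suc m
1/fromℕ m = sym (ℚ.normalize-coprime (1-coprimeTo (suc m)))

m≤n/o⇔m*o≤n : ∀ m n o .{{_ : ℕ.NonZero o}} → m ℕ.≤ n ℕ./ o ⇔ m ℕ.* o ℕ.≤ n
m≤n/o⇔m*o≤n m n o = mk⇔
  (λ m≤n/o → ℕ.≤-trans (ℕ.*-monoˡ-≤ o m≤n/o) (ℕ.m/n*n≤m n o))
  (λ m*o≤n → subst (ℕ._≤ n ℕ./ o) (ℕ.m*n/n≡m m o) (ℕ./-monoˡ-≤ o m*o≤n))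

fromℕ≤⇔ : ∀ m n d .{c : Coprime n (suc d)} → fromℕ m ℚ.≤ mkℚ (+ n) d c ⇔ m ℕ.* suc d ℕ.≤ n
fromℕ≤⇔ m n d = mk⇔
  (λ { (*≤* le) → ℤ.drop‿+≤+ (subst₂ ℤ._≤_ (sym (ℤ.pos-* m (suc d))) (ℤ.*-identityʳ (+ n)) le) })
  (λ le → *≤* (subst₂ ℤ._≤_ (ℤ.pos-* m (suc d)) (sym (ℤ.*-identityʳ (+ n))) (+≤+ le)))

floor-+ : ∀ n d .{c : Coprime n (suc d)} → floor (mkℚ (+ n) d c) ≡ + (n ℕ./ suc d)
floor-+ n d = ℤ.*-identityˡ _

floor-nonNeg : ∀ q → 0ℚ ℚ.≤ q → floor q ≡ + ℤ.∣ floor q ∣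
floor-nonNeg (mkℚ (+ n) d c) _ = trans (floor-+ n d {c}) (cong (+_ ∘ ℤ.∣_∣) (sym (floor-+ n d {c})))
floor-nonNeg (mkℚ -[1+ _ ] _ _) (*≤* ())

m≤∣floor∣⇔fromℕ≤ : ∀ m q → 0ℚ ℚ.≤ q → m ℕ.≤ ℤ.∣ floor q ∣ ⇔ fromℕ m ℚ.≤ q
m≤∣floor∣⇔fromℕ≤ m q@(mkℚ (+ n) d c) _ = begin
  m ℕ.≤ ℤ.∣ floor q ∣       ≡⟨ cong (λ z → m ℕ.≤ ℤ.∣ z ∣) (floor-+ n d {c}) ⟩
  m ℕ.≤ n ℕ./ suc d         ∼⟨ m≤n/o⇔m*o≤n m n (suc d) ⟩
  m ℕ.* suc d ℕ.≤ n         ∼⟨ ⇔-sym (fromℕ≤⇔ m n d) ⟩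
  fromℕ m ℚ.≤ q             ∎
  where open Related.EquationalReasoning
m≤∣floor∣⇔fromℕ≤ m (mkℚ -[1+ _ ] _ _) (*≤* ())

p≤q÷r⇔p*r≤q : ∀ {p q r} (r>0 : 0ℚ ℚ.< r) → p ℚ.≤ (q ÷ r) {{>-nonZero r>0}} ⇔ p ℚ.* r ℚ.≤ q
p≤q÷r⇔p*r≤q {p} {q} {r} r>0 = mk⇔
  (λ p≤q÷r → subst (p ℚ.* r ℚ.≤_) (cancel q (1/ r) r (ℚ.*-inverseˡ r)) (ℚ.*-monoʳ-≤-nonNeg r p≤q÷r))
  (λ p*r≤q → subst (ℚ._≤ q ÷ r) (cancel p r (1/ r) (ℚ.*-inverseʳ r)) (ℚ.*-monoʳ-≤-nonNeg (1/ r) p*r≤q))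
  where
  instance
    r≢0 : ℚ.NonZero r
    r≢0 = >-nonZero r>0
    r≥0 : ℚ.NonNegative r
    r≥0 = ℚ.nonNegative (ℚ.<⇒≤ r>0)
    1/r≥0 : ℚ.NonNegative (1/ r)
    1/r≥0 = ℚ.pos⇒nonNeg ((1/ r) {{r≢0}}) {{ℚ.1/pos⇒pos r {{ℚ.positive r>0}}}}
  cancel : ∀ a b c → b ℚ.* c ≡ ℚ.1ℚ → a ℚ.* b ℚ.* c ≡ a
  cancel a b c bc≡1 = trans (ℚ.*-assoc a b c) (trans (cong (a ℚ.*_) bc≡1) (ℚ.*-identityʳ a))

pieces : (L l : ℚ) → 0ℚ ℚ.< l → ℕ
pieces L l l>0 = ℤ.∣ floor ((L ÷ l) {{>-nonZero l>0}}) ∣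

module _ {L l : ℚ} (L≥0 : 0ℚ ℚ.≤ L) (l>0 : 0ℚ ℚ.< l) where
  private instance
    l≢0 = >-nonZero l>0

  L÷l≥0 : 0ℚ ℚ.≤ L ÷ l
  L÷l≥0 = ℚ.nonNegative⁻¹ _ {{ℚ.nonNeg*nonNeg⇒nonNeg L {{ℚ.nonNegative L≥0}} (1/ l) {{1/l≥0}}}}
    where
    1/l≥0 : ℚ.NonNegative (1/ l)
    1/l≥0 = ℚ.pos⇒nonNeg ((1/ l) {{l≢0}}) {{ℚ.1/pos⇒pos l {{ℚ.positive l>0}}}}

  floor-÷≡pieces : floor (L ÷ l) ≡ + pieces L l l>0
  floor-÷≡pieces = floor-nonNeg (L ÷ l) L÷l≥0

  <-pieces⇔ : ∀ j → j ℕ.< pieces L l l>0 ⇔ l ℚ.≤ L ℚ.* (+ 1 ℚ./ suc j)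
  <-pieces⇔ j = begin
    suc j ℕ.≤ pieces L l l>0                 ∼⟨ m≤∣floor∣⇔fromℕ≤ (suc j) (L ÷ l) L÷l≥0 ⟩
    fromℕ (suc j) ℚ.≤ L ÷ l                  ∼⟨ p≤q÷r⇔p*r≤q l>0 ⟩
    fromℕ (suc j) ℚ.* l ℚ.≤ L                ≡⟨ cong (ℚ._≤ L) (ℚ.*-comm (fromℕ (suc j)) l) ⟩
    l ℚ.* fromℕ (suc j) ℚ.≤ L                ∼⟨ ⇔-sym (p≤q÷r⇔p*r≤q (ℚ.*<* (ℤ.+<+ (s≤s z≤n)))) ⟩
    l ℚ.≤ L ÷ fromℕ (suc j)                  ≡⟨ cong (λ z → l ℚ.≤ L ℚ.* z) (1/fromℕ j) ⟩
    l ℚ.≤ L ℚ.* (+ 1 ℚ./ suc j)              ∎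
    where open Related.EquationalReasoning

isStrictTotalOrder-≡ : ∀ {A : Set} {_≈_ _<_ : Rel A 0ℓ} → (∀ {x y} → x ≈ y → x ≡ y) →
                       IsStrictTotalOrder _≈_ _<_ → IsStrictTotalOrder _≡_ _<_
isStrictTotalOrder-≡ {_<_ = _<_} ≈⇒≡ sto = record
  { isStrictPartialOrder = record
    { isEquivalence = isEquivalence
    ; irrefl        = λ { refl → S.irrefl S.Eq.refl }
    ; trans         = S.trans
    ; <-resp-≈      = resp₂ _<_
    }
  ; compare = compare
  }
  where
  module S = IsStrictTotalOrder sto
  compare : Trichotomous _≡_ _<_
  compare x y with S.compare x y
  ... | tri< x<y x≉y x≯y = tri< x<y (x≉y ∘ S.Eq.reflexive) x≯y
  ... | tri≈ x≮y x≈y x≯y = tri≈ x≮y (≈⇒≡ x≈y) x≯y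
  ... | tri> x≮y x≉y x>y = tri> x≮y (x≉y ∘ S.Eq.reflexive) x>y

module Enumeration {I : Set} {_≺_ : Rel I 0ℓ} (≺-isStrictTotalOrder : IsStrictTotalOrder _≡_ _≺_)
  (initial : I → List I) (initial-unique : ∀ e → Unique (initial e))
  (∈-initial : ∀ {e f} → f ∈ initial e ⇔ f ≺ e)
  (unbounded : ∀ p → ∃ λ e → p ℕ.< length (initial e)) where

  open IsStrictTotalOrder ≺-isStrictTotalOrder using (compare; irrefl) renaming (trans to ≺-trans)
  open Equivalence

  rank : I → ℕ
  rank e = length (initial e)

  rank-strictMono : ∀ {e f} → f ≺ e → rank f ℕ.< rank e
  rank-strictMono {e} {f} f≺e = Unique-⊆⇒length< (initial-unique f)
    (λ g∈ → from ∈-initial (≺-trans (to ∈-initial g∈) f≺e))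
    (from ∈-initial f≺e) (irrefl refl ∘ to ∈-initial)

  rank-injective : ∀ {e f} → rank e ≡ rank f → e ≡ f
  rank-injective {e} {f} re≡rf with compare e f
  ... | tri< e≺f _ _ = contradiction re≡rf (ℕ.<⇒≢ (rank-strictMono e≺f))
  ... | tri≈ _ e≡f _ = e≡f
  ... | tri> _ _ f≺e = contradiction re≡rf (ℕ.>⇒≢ (rank-strictMono f≺e))

  ranks-below : ∀ e → upTo (rank e) ⊆ map rank (initial e)
  ranks-below e = Unique-⊆-length≥⇒⊇ ℕ._≟_ (Unique.map⁺ {f = rank} rank-injective (initial-unique e))
    (map-⊆ (∈-upTo⁺ ∘ rank-strictMono ∘ to ∈-initial))
    (ℕ.≤-reflexive (trans (length-upTo (rank e)) (sym (length-map rank (initial e)))))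

  opaque
    rank-surjective : ∀ p → ∃ λ e → rank e ≡ p
    rank-surjective p =
      let e , p<re = unbounded p
          f , _ , p≡rf = ∈-map⁻ rank (ranks-below e (∈-upTo⁺ p<re))
      in f , sym p≡rf

    unrank : ℕ → I
    unrank p = proj₁ (rank-surjective p)

    rank-unrank : ∀ p → rank (unrank p) ≡ p
    rank-unrank p = proj₂ (rank-surjective p)

  unrank-rank : ∀ e → unrank (rank e) ≡ e
  unrank-rank e = rank-injective (rank-unrank (rank e))

  enumeration : ℕ ⤖ I
  enumeration = ↔⇒⤖ (mk↔ₛ′ unrank rank unrank-rank rank-unrank)

  unrank-injective : ∀ {p q} → unrank p ≡ unrank q → p ≡ q
  unrank-injective {p} {q} eq = trans (sym (rank-unrank p)) (trans (cong rank eq) (rank-unrank q))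

  unrank-≤⇒⊀ : ∀ {p q} → p ℕ.≤ q → ¬ (unrank q ≺ unrank p)
  unrank-≤⇒⊀ {p} {q} p≤q uq≺up =
    ℕ.<⇒≱ (subst₂ ℕ._<_ (rank-unrank q) (rank-unrank p) (rank-strictMono uq≺up)) p≤q

module SortedByValue {n} (i₀ : Fin n) (val : Fin n × ℕ → ℚ) (val>0 : ∀ e → 0ℚ ℚ.< val e)
  (count : Fin n → (l : ℚ) → 0ℚ ℚ.< l → ℕ)
  (<-count⇔ : ∀ {i j l} (l>0 : 0ℚ ℚ.< l) → j ℕ.< count i l l>0 ⇔ l ℚ.≤ val (i , j)) where

  open Equivalence

  _⊏_ : Rel (Fin n × ℕ) 0ℓ
  _⊏_ = ×-Lex _≡_ Fin._<_ ℕ._<_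

  _≺_ : Rel (Fin n × ℕ) 0ℓ
  _≺_ = ×-Lex _≡_ (flip ℚ._<_) _⊏_ on λ e → val e , e

  ≺-isStrictTotalOrder : IsStrictTotalOrder _≡_ _≺_
  ≺-isStrictTotalOrder = isStrictTotalOrder-≡ (≡×≡⇒≡ ∘ proj₂) (On.isStrictTotalOrder _
    (×-isStrictTotalOrder (Flip.isStrictTotalOrder ℚ.<-isStrictTotalOrder)
      (×-isStrictTotalOrder Fin.<-isStrictTotalOrder ℕ.<-isStrictTotalOrder)))

  open IsStrictTotalOrder ≺-isStrictTotalOrder using () renaming (_<?_ to _≺?_)

  ≺⇒≥ : ∀ {e f} → f ≺ e → val e ℚ.≤ val f
  ≺⇒≥ (inj₁ ve<vf) = ℚ.<⇒≤ ve<vf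
  ≺⇒≥ (inj₂ (vf≡ve , _)) = ℚ.≤-reflexive (sym vf≡ve)

  ≥∧⊏⇒≺ : ∀ {e f} → val e ℚ.≤ val f → f ⊏ e → f ≺ e
  ≥∧⊏⇒≺ {e} {f} ve≤vf f⊏e with ℚ.<-cmp (val e) (val f)
  ... | tri< ve<vf _ _ = inj₁ ve<vf
  ... | tri≈ _ ve≡vf _ = inj₂ (sym ve≡vf , f⊏e)
  ... | tri> _ _ vf<ve = contradiction (ℚ.<-≤-trans vf<ve ve≤vf) (ℚ.<-irrefl refl)

  superlevel : (l : ℚ) → 0ℚ ℚ.< l → List (Fin n × ℕ)
  superlevel l l>0 = grid (λ i → count i l l>0)

  ∈-superlevel : ∀ {l} (l>0 : 0ℚ ℚ.< l) {e} → e ∈ superlevel l l>0 ⇔ l ℚ.≤ val e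
  ∈-superlevel l>0 {i , j} = mk⇔ (to (<-count⇔ l>0) ∘ ∈-grid⁻ _) (∈-grid⁺ _ ∘ from (<-count⇔ l>0))

  initial : Fin n × ℕ → List (Fin n × ℕ)
  initial e = filter (_≺? e) (superlevel (val e) (val>0 e))

  ∈-initial : ∀ {e f} → f ∈ initial e ⇔ f ≺ e
  ∈-initial {e} = mk⇔ (proj₂ ∘ ∈-filter⁻ (_≺? e) {xs = superlevel (val e) (val>0 e)})
    (λ f≺e → ∈-filter⁺ (_≺? e) (from (∈-superlevel (val>0 e)) (≺⇒≥ f≺e)) f≺e)

  initial-unique : ∀ e → Unique (initial e)
  initial-unique e = Unique.filter⁺ (_≺? e) (grid-unique _)

  unbounded : ∀ p → ∃ λ e → p ℕ.< length (initial e)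
  unbounded p = e , (begin
    suc p                                ≡⟨ trans (length-map (i₀ ,_) (upTo (suc p))) (length-upTo (suc p)) ⟨
    length (map (i₀ ,_) (upTo (suc p)))  ≤⟨ Unique-⊆⇒length≤ row-unique row⊆initial ⟩
    length (initial e)                   ∎)
    where
    open ℕ.≤-Reasoning
    e = (i₀ , suc p)
    row-unique : Unique (map (i₀ ,_) (upTo (suc p)))
    row-unique = Unique.map⁺ (cong proj₂) (Unique.upTo⁺ (suc p))
    -- The row of i₀ is non-increasing, so its first p + 1 entries all precede e.
    row⊆initial : map (i₀ ,_) (upTo (suc p)) ⊆ initial e
    row⊆initial = map-⊆ λ j∈ → from ∈-initial (≥∧⊏⇒≺
      (to (<-count⇔ (val>0 e)) (ℕ.<-trans (∈-upTo⁻ j∈) (from (<-count⇔ (val>0 e)) ℚ.≤-refl)))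
      (inj₂ (refl , ∈-upTo⁻ j∈)))

  open Enumeration ≺-isStrictTotalOrder initial initial-unique ∈-initial unbounded public

  unrank-antitone : ∀ p q → p ℕ.≤ q → val (unrank q) ℚ.≤ val (unrank p)
  unrank-antitone p q p≤q = ℚ.≮⇒≥ (unrank-≤⇒⊀ p≤q ∘ inj₁)

  unrank-feasible : ∀ k → suc k ℕ.≤ length (superlevel (val (unrank k)) (val>0 (unrank k)))
  unrank-feasible k = begin
    suc k                               ≡⟨ trans (length-map unrank (upTo (suc k))) (length-upTo (suc k)) ⟨
    length (map unrank (upTo (suc k)))  ≤⟨ Unique-⊆⇒length≤ first-unique first⊆superlevel ⟩
    length (superlevel x (val>0 (unrank k)))  ∎
    where
    open ℕ.≤-Reasoning
    x = val (unrank k)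
    first-unique : Unique (map unrank (upTo (suc k)))
    first-unique = Unique.map⁺ {f = unrank} unrank-injective (Unique.upTo⁺ (suc k))
    first⊆superlevel : map unrank (upTo (suc k)) ⊆ superlevel x (val>0 (unrank k))
    first⊆superlevel = map-⊆ λ {p} p∈ →
      from (∈-superlevel (val>0 (unrank k))) (unrank-antitone p k (ℕ.≤-pred (∈-upTo⁻ p∈)))

  unrank-maximal : ∀ k {l} (l>0 : 0ℚ ℚ.< l) → suc k ℕ.≤ length (superlevel l l>0) →
                   l ℚ.≤ val (unrank k)
  unrank-maximal k {l} l>0 k<∣superlevel∣ = ℚ.≮⇒≥ λ uk<l → ℕ.<⇒≱ k<∣superlevel∣ (begin
    length (superlevel l l>0)  ≤⟨ Unique-⊆⇒length≤ (grid-unique _) (superlevel⊆initial uk<l) ⟩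
    rank (unrank k)            ≡⟨ rank-unrank k ⟩
    k                          ∎)
    where
    open ℕ.≤-Reasoning
    superlevel⊆initial : val (unrank k) ℚ.< l → superlevel l l>0 ⊆ initial (unrank k)
    superlevel⊆initial uk<l f∈ = from ∈-initial (inj₁ (ℚ.<-≤-trans uk<l (to (∈-superlevel l>0) f∈)))

Call>0 : ∀ {n} (L : Fin n → ℚ) → (∀ i → 0ℚ ℚ.< L i) → ∀ e → 0ℚ ℚ.< Call L e
Call>0 L L>0 (i , j) = ℚ.positive⁻¹ _
  {{ℚ.pos*pos⇒pos (L i) {{ℚ.positive (L>0 i)}} (+ 1 ℚ./ suc j) {{ℚ.normalize-pos 1 (suc j)}}}}

m≡length-grid : ∀ {n} (L : Fin n → ℚ) → (∀ i → 0ℚ ℚ.≤ L i) → ∀ {l} (l>0 : 0ℚ ℚ.< l) →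
                m L l l>0 ≡ + length (grid (λ i → pieces (L i) l l>0))
m≡length-grid L L≥0 {l} l>0 =
  trans (sumFin-cong (λ i → floor-÷≡pieces (L≥0 i) l>0)) (sym (length-grid (λ i → pieces (L i) l l>0)))

lemma7 : (n : ℕ) → 1 ℕ.≤ n → (L : Fin n → ℚ) → (∀ i → 0ℚ ℚ.< L i) →
         (k : ℕ) → 1 ℕ.≤ k →
         ∃ λ x → IsMaxFeasible L k x × IsKthLargest (Call L) k x
lemma7 (suc n) _ L L>0 (suc k) _ =
    Call L (unrank k)
  , ((Call>0 L L>0 (unrank k) , feasible) , maximal)
  , (enumeration , unrank-antitone , refl)
  where
  L≥0 : ∀ i → 0ℚ ℚ.≤ L i
  L≥0 = ℚ.<⇒≤ ∘ L>0
  open SortedByValue zero (Call L) (Call>0 L L>0) (pieces ∘ L) (λ {i} l>0 → <-pieces⇔ (L≥0 i) l>0 _)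
  feasible : + suc k ℤ.≤ m L (Call L (unrank k)) (Call>0 L L>0 (unrank k))
  feasible = subst (+ suc k ℤ.≤_) (sym (m≡length-grid L L≥0 (Call>0 L L>0 (unrank k))))
                   (+≤+ (unrank-feasible k))
  maximal : ∀ l → Feasible L (suc k) l → l ℚ.≤ Call L (unrank k)
  maximal l (l>0 , k<m) =
    unrank-maximal k l>0 (ℤ.drop‿+≤+ (subst (+ suc k ℤ.≤_) (m≡length-grid L L≥0 l>0) k<m))
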